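{- For every non-trivial tree $T_r$ rooted on $r$, we have $k \leq \mathrm{thin}(T_r) \leq k+1$, where $k$ is the maximum, over all children $v$ of $r$, of the thinness of the subtree of $T_r$ induced by $v$ and its descendants.
   Context: A graph $G$ is $k$-thin if there exist a strict total order $\prec$ on $V(G)$ and a partition of $V(G)$ into $k$ classes such that for all $u \prec v \prec w$ with $u,v$ in the same class and $(u,w)\in E(G)$, also $(v,w)\in E(G)$; the thinness $\mathrm{thin}(G)$ is the minimum such $k$. -}

module Defs where

open import Data.Nat using (ℕ; zero; suc; _≤_; _<_)
open import Data.Fin using (Fin)
open import Data.List using (List; length; lookup)
open import Data.Product using (Σ; _×_)
open import Data.Sum using (_⊎_)
open import Relation.Binary.PropositionalEquality using (_≡_)
open import Relation.Binary.Structures using (IsStrictTotalOrder)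

record Graph : Set₁ where
  field
    V : Set
    E : V → V → Set
open Graph public

IsKThin : Graph → ℕ → Set₁
IsKThin G k =
  Σ (V G → V G → Set) λ _≺_ →
  Σ (V G → Fin k) λ cls →
    IsStrictTotalOrder _≡_ _≺_ ×
    (∀ u v w → u ≺ v → v ≺ w → cls u ≡ cls v → E G u w → E G v w)

Thinness : Graph → ℕ → Set₁
Thinness G t = IsKThin G t × (∀ j → IsKThin G j → t ≤ j)

data Tree : Set where
  node : List Tree → Tree

data Pos : Tree → Set where
  root : ∀ {t} → Pos t
  sub  : ∀ {ts} (i : Fin (length ts)) → Pos (lookup ts i) → Pos (node ts)

data ParentOf : ∀ {t} → Pos t → Pos t → Set where
  top    : ∀ {ts} (i : Fin (length ts)) → ParentOf (root {node ts}) (sub i root)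
  deeper : ∀ {ts} (i : Fin (length ts)) {p q : Pos (lookup ts i)} →
           ParentOf p q → ParentOf (sub {ts} i p) (sub i q)

treeGraph : Tree → Graph
treeGraph t = record
  { V = Pos t
  ; E = λ p q → ParentOf p q ⊎ ParentOf q p
  }

MaxChildThinness : List Tree → ℕ → Set₁
MaxChildThinness ts k =
  Σ (Fin (length ts)) (λ i → Thinness (treeGraph (lookup ts i)) k) ×
  (∀ (i : Fin (length ts)) (s : ℕ) → Thinness (treeGraph (lookup ts i)) s → s ≤ k)

-- Each child subtree is an induced subgraph of the tree, and thinness is
-- monotone under induced subgraphs, so k ≤ t. Conversely, order the root
-- first and then the child subtrees one after the other, each with a
-- k-thin order of its own; since no edge joins two different subtrees,
-- the child classes can be shared, and the root alone in a fresh class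
-- gives a (k+1)-thin order. Constructively, that each child is k-thin is
-- only known up to double negation (the least thinness of a child exists
-- classically); decidability of ≤ on ℕ removes it at the end.
module Submission where

open import Defs
open import Data.Nat using (ℕ; suc; _≤_; _<_; _⊔_; _≤?_)
open import Data.Nat.Properties using (m≤m⊔n; m≤n⊔m; ≰⇒>)
open import Data.Nat.Induction using (<-rec)
open import Data.Fin as Fin using (Fin; inject₁; inject≤; fromℕ)
open import Data.Fin.Properties as FinP
  using (inject≤-injective; inject₁-injective; fromℕ≢inject₁; sequence)
open import Data.List using (List; []; _∷_; length; lookup)
open import Data.Product using (∃; _×_; _,_; proj₁; proj₂)
open import Data.Sum as Sum using (inj₁; inj₂)
open import Function using (_∘_)
open import Effect.Monad using (RawMonad)
open import Level using (Level)
open import Relation.Nullary using (¬_)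
open import Relation.Nullary.Decidable using (decidable-stable)
open import Relation.Nullary.Negation using (¬¬-Monad; ¬¬-map; contradiction)
open import Relation.Binary.Definitions using (Tri; tri<; tri≈; tri>)
open import Relation.Binary.PropositionalEquality
open import Relation.Binary.Structures using (IsStrictTotalOrder)
open import Relation.Binary.Structures.Biased using (isStrictTotalOrderᶜ)

private
  variable
    ℓ : Level
    k n : ℕ
    G H : Graph

IsKThin-mono : ∀ G {a b} → a ≤ b → IsKThin G a → IsKThin G b
IsKThin-mono G a≤b (_≺_ , cls , isSTO , thin) =
  _≺_ , (λ x → inject≤ (cls x) a≤b) , isSTO ,
  λ u v w u≺v v≺w same e →
    thin u v w u≺v v≺w (inject≤-injective a≤b a≤b _ _ same) e

record InducedEmbedding (H G : Graph) : Set where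
  field
    embed     : V H → V G
    injective : ∀ {u v} → embed u ≡ embed v → u ≡ v
    preserves : ∀ {u v} → E H u v → E G (embed u) (embed v)
    reflects  : ∀ {u v} → E G (embed u) (embed v) → E H u v

IsKThin-induced : InducedEmbedding H G → IsKThin G k → IsKThin H k
IsKThin-induced {H} ι (_≺_ , cls , isSTO , thin) =
  _≺ᴴ_ , cls ∘ embed , isSTOᴴ ,
  λ u v w u≺v v≺w same e → reflects (thin _ _ _ u≺v v≺w same (preserves e))
  where
  open InducedEmbedding ι
  module ≺ = IsStrictTotalOrder isSTO

  _≺ᴴ_ : V H → V H → Set
  u ≺ᴴ v = embed u ≺ embed v

  compareᴴ : ∀ u v → Tri (u ≺ᴴ v) (u ≡ v) (v ≺ᴴ u)
  compareᴴ u v with ≺.compare (embed u) (embed v)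
  ... | tri< a ¬b ¬c = tri< a (λ u≡v → ¬b (cong embed u≡v)) ¬c
  ... | tri≈ ¬a b ¬c = tri≈ ¬a (injective b) ¬c
  ... | tri> ¬a ¬b c = tri> ¬a (λ u≡v → ¬b (cong embed u≡v)) c

  isSTOᴴ : IsStrictTotalOrder _≡_ _≺ᴴ_
  isSTOᴴ = isStrictTotalOrderᶜ record
    { isEquivalence = isEquivalence ; trans = ≺.trans ; compare = compareᴴ }

module _ {ts : List Tree} where

  sub-injective : ∀ {i} {p q : Pos (lookup ts i)} → sub {ts} i p ≡ sub i q → p ≡ q
  sub-injective refl = refl

  ParentOf-sub-index : ∀ {i j} {p : Pos (lookup ts i)} {q : Pos (lookup ts j)} →
                       ParentOf (sub {ts} i p) (sub j q) → i ≡ j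
  ParentOf-sub-index (deeper _ _) = refl

  ParentOf-sub⁻ : ∀ {i} {p q : Pos (lookup ts i)} →
                  ParentOf (sub {ts} i p) (sub i q) → ParentOf p q
  ParentOf-sub⁻ (deeper _ p→q) = p→q

  edge-sub-index : ∀ {i j} {p : Pos (lookup ts i)} {q : Pos (lookup ts j)} →
                   E (treeGraph (node ts)) (sub i p) (sub j q) → i ≡ j
  edge-sub-index (inj₁ p→q) = ParentOf-sub-index p→q
  edge-sub-index (inj₂ q→p) = sym (ParentOf-sub-index q→p)

  subtreeEmbedding : ∀ i → InducedEmbedding (treeGraph (lookup ts i)) (treeGraph (node ts))
  subtreeEmbedding i = record
    { embed     = sub i
    ; injective = sub-injective
    ; preserves = Sum.map (deeper i) (deeper i)
    ; reflects  = Sum.map ParentOf-sub⁻ ParentOf-sub⁻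
    }

module RootThenSubtrees (ts : List Tree) {k : ℕ}
    (child-thin : ∀ i → IsKThin (treeGraph (lookup ts i)) k) where

  private
    Child : Fin (length ts) → Graph
    Child i = treeGraph (lookup ts i)

    childOrder : ∀ i → V (Child i) → V (Child i) → Set
    childOrder i = proj₁ (child-thin i)

    class : ∀ i → V (Child i) → Fin k
    class i = proj₁ (proj₂ (child-thin i))

    module ≺ i = IsStrictTotalOrder (proj₁ (proj₂ (proj₂ (child-thin i))))

    child-thinness : ∀ i u v w → childOrder i u v → childOrder i v w →
                     class i u ≡ class i v → E (Child i) u w → E (Child i) v w
    child-thinness i = proj₂ (proj₂ (proj₂ (child-thin i)))

  data _≺_ : Pos (node ts) → Pos (node ts) → Set where
    root≺sub  : ∀ i p → root ≺ sub i p
    sub≺sub   : ∀ {i j} p q → i Fin.< j → sub i p ≺ sub j q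
    within    : ∀ i {p q} → childOrder i p q → sub i p ≺ sub i q

  ≺-irrefl : ∀ {x} → ¬ x ≺ x
  ≺-irrefl (sub≺sub _ _ i<i) = FinP.<-irrefl refl i<i
  ≺-irrefl (within i p≺p)    = ≺.irrefl i refl p≺p

  ≺-trans : ∀ {x y z} → x ≺ y → y ≺ z → x ≺ z
  ≺-trans (root≺sub _ _)    (sub≺sub _ q _)   = root≺sub _ q
  ≺-trans (root≺sub i _)    (within _ _)      = root≺sub i _
  ≺-trans (sub≺sub p _ i<j) (sub≺sub _ r j<l) = sub≺sub p r (FinP.<-trans i<j j<l)
  ≺-trans (sub≺sub p _ i<j) (within _ _)      = sub≺sub p _ i<j
  ≺-trans (within _ _)      (sub≺sub _ r j<l) = sub≺sub _ r j<l
  ≺-trans (within i p≺q)    (within _ q≺r)    = within i (≺.trans i p≺q q≺r)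

  ≺-asym : ∀ {x y} → x ≺ y → ¬ y ≺ x
  ≺-asym x≺y y≺x = ≺-irrefl (≺-trans x≺y y≺x)

  private
    tri≺ : ∀ {x y} → x ≺ y → Tri (x ≺ y) (x ≡ y) (y ≺ x)
    tri≺ x≺y = tri< x≺y (λ { refl → ≺-irrefl x≺y }) (≺-asym x≺y)

    tri≻ : ∀ {x y} → y ≺ x → Tri (x ≺ y) (x ≡ y) (y ≺ x)
    tri≻ y≺x = tri> (≺-asym y≺x) (λ { refl → ≺-irrefl y≺x }) y≺x

  ≺-compare : ∀ x y → Tri (x ≺ y) (x ≡ y) (y ≺ x)
  ≺-compare root      root      = tri≈ ≺-irrefl refl ≺-irrefl
  ≺-compare root      (sub i p) = tri≺ (root≺sub i p)
  ≺-compare (sub i p) root      = tri≻ (root≺sub i p)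
  ≺-compare (sub i p) (sub j q) with FinP.<-cmp i j
  ... | tri< i<j _ _ = tri≺ (sub≺sub p q i<j)
  ... | tri> _ _ j<i = tri≻ (sub≺sub q p j<i)
  ... | tri≈ _ refl _ with ≺.compare i p q
  ...   | tri< p≺q _ _ = tri≺ (within i p≺q)
  ...   | tri≈ _ refl _ = tri≈ ≺-irrefl refl ≺-irrefl
  ...   | tri> _ _ q≺p = tri≻ (within i q≺p)

  nodeClass : Pos (node ts) → Fin (suc k)
  nodeClass root      = fromℕ k
  nodeClass (sub i p) = inject₁ (class i p)

  nodeThinness : ∀ u v w → u ≺ v → v ≺ w → nodeClass u ≡ nodeClass v →
                 E (treeGraph (node ts)) u w → E (treeGraph (node ts)) v w
  nodeThinness _ _ _ (root≺sub _ _)    _                 same _ =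
    contradiction same fromℕ≢inject₁
  nodeThinness _ _ _ (sub≺sub _ _ i<j) (sub≺sub _ _ j<l) _    e =
    contradiction (FinP.<-trans i<j j<l) (FinP.<-irrefl (edge-sub-index e))
  nodeThinness _ _ _ (sub≺sub _ _ i<j) (within _ _)      _    e =
    contradiction i<j (FinP.<-irrefl (edge-sub-index e))
  nodeThinness _ _ _ (within _ _)      (sub≺sub _ _ j<l) _    e =
    contradiction j<l (FinP.<-irrefl (edge-sub-index e))
  nodeThinness _ _ _ (within i p≺q)    (within _ q≺r)    same e =
    preserves (child-thinness i _ _ _ p≺q q≺r (inject₁-injective same) (reflects e))
    where open InducedEmbedding (subtreeEmbedding {ts} i)

  isKThin : IsKThin (treeGraph (node ts)) (suc k)
  isKThin = _≺_ , nodeClass ,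
    isStrictTotalOrderᶜ record
      { isEquivalence = isEquivalence ; trans = ≺-trans ; compare = ≺-compare } ,
    nodeThinness

IsKThin-node : ∀ ts → (∀ i → IsKThin (treeGraph (lookup ts i)) k) →
               IsKThin (treeGraph (node ts)) (suc k)
IsKThin-node ts child-thin = RootThenSubtrees.isKThin ts child-thin

mutual
  tree-IsKThin : ∀ t → ∃ (IsKThin (treeGraph t))
  tree-IsKThin (node ts) =
    let k , child-thin = forest-IsKThin ts in suc k , IsKThin-node ts child-thin

  forest-IsKThin : ∀ ts → ∃ λ k → ∀ i → IsKThin (treeGraph (lookup ts i)) k
  forest-IsKThin []       = 0 , λ ()
  forest-IsKThin (t ∷ ts) =
    let a , t-thin = tree-IsKThin t
        b , ts-thin = forest-IsKThin ts
    in a ⊔ b , λ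
      { Fin.zero    → IsKThin-mono _ (m≤m⊔n a b) t-thin
      ; (Fin.suc i) → IsKThin-mono _ (m≤n⊔m a b) (ts-thin i) }

¬¬-least : ∀ {P : ℕ → Set ℓ} {n} → P n → ¬ ¬ (∃ λ m → P m × ∀ j → P j → m ≤ j)
¬¬-least {P = P} {n} = <-rec (λ n → P n → ¬ ¬ _) step n
  where
  step : ∀ n → (∀ {j} → j < n → P j → ¬ ¬ _) → P n → ¬ ¬ _
  step n below pn no-least = no-least (n , pn , λ j pj →
    decidable-stable (n ≤? j) (λ n≰j → below (≰⇒> n≰j) pj no-least))

IsKThin-bounded : IsKThin G n → (∀ s → Thinness G s → s ≤ k) → ¬ ¬ IsKThin G k
IsKThin-bounded {G} n-thin bound = ¬¬-map
  (λ (s , s-thin) → IsKThin-mono G (bound s s-thin) (proj₁ s-thin))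
  (¬¬-least n-thin)

lemma28 : (ts : List Tree) → 0 < length ts → (t k : ℕ) →
          Thinness (treeGraph (node ts)) t → MaxChildThinness ts k →
          k ≤ t × t ≤ suc k
-- Nonemptiness of ts is unused: MaxChildThinness already supplies a child j.
lemma28 ts _ t k (t-thin , t-least) ((j , (_ , k-least)) , k-max) =
  k-least t (IsKThin-induced (subtreeEmbedding j) t-thin) ,
  decidable-stable (t ≤? suc k)
    (¬¬-map (λ children → t-least (suc k) (IsKThin-node ts children)) children-k-thin)
  where
  children-k-thin : ¬ ¬ (∀ i → IsKThin (treeGraph (lookup ts i)) k)
  children-k-thin = sequence (RawMonad.rawApplicative ¬¬-Monad) λ i →
    IsKThin-bounded (proj₂ (tree-IsKThin (lookup ts i))) (k-max i)
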